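{- If an instance of $\textsc{Solo Chess}(\{S^1,T\})$ has a solution, then it has a solution in which the sequence of locations visited by the hero forms a hero path.
   Context: Generalized model: a board is a finite set $L$ of locations with pieces at distinct locations; standing assumption: every location is initially occupied. A move is a sequence $\langle \ell_0,\dots,\ell_k\rangle$ of locations ($k\ge1$), valid if $\ell_0,\ell_k$ are occupied and $\ell_1,\dots,\ell_{k-1}$ are empty; executing it removes the piece at $\ell_k$ and moves the piece at $\ell_0$ there. A piece type is a set of moves; it is closed under submoves if $\langle \ell_0,\dots,\ell_k\rangle\in T$ implies $\langle\ell_i,\dots,\ell_j\rangle\in T$ for all $0\le i<j\le k$, and symmetric if closed under reversing sequences. Standing assumptions: $S,T$ are piece types closed under submoves, $S\subseteq T$, and $T$ is symmetric. $\textsc{Solo Chess}(\{S^1,T\})$: the board has exactly one piece of type $S$ (the hero), all other pieces are of type $T$ (villains); a solution is a sequence of valid moves (each in the type of the moving piece) that never captures the hero and leaves only the hero. A hero path is a sequence of locations $p_0,\dots,p_k$ with $p_0$ the hero's initial location such that the hero has moves in $S$ from $p_0$ to $p_1$, from $p_1$ to $p_2$, ..., from $p_{k-1}$ to $p_k$ that are valid when executed in succession in the initial board with no other moves made. -}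

module Defs where

open import Data.Nat using (ℕ; _≤_)
open import Data.Fin using (Fin; _≟_)
open import Data.List using (List; []; _∷_; _++_; length; reverse)
open import Data.List.Relation.Unary.All using (All)
open import Data.Product using (Σ; ∃; _×_; _,_)
open import Data.Empty using (⊥)
open import Relation.Nullary using (¬_; yes; no)
open import Relation.Binary.PropositionalEquality using (_≡_; _≢_)

data Occ : Set where
  empty villain hero : Occ

State : ℕ → Set
State n = Fin n → Occ

initial : ∀ {n} → Fin n → State n
initial h ℓ with ℓ ≟ h
... | yes _ = hero
... | no  _ = villain

-- A move ⟨ℓ₀,…,ℓ_k⟩ with k ≥ 1: start ℓ₀, interior ℓ₁…ℓ_{k-1}, end ℓ_k.
record Move (n : ℕ) : Set where
  constructor mkMove
  field
    start : Fin n
    mid   : List (Fin n)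
    end   : Fin n
open Move public

toList : ∀ {n} → Move n → List (Fin n)
toList m = start m ∷ (mid m ++ end m ∷ [])

-- A piece type is a set of moves (location sequences; only sequences of
-- length ≥ 2 are ever consulted).
PieceType : ℕ → Set₁
PieceType n = List (Fin n) → Set

ClosedUnderSubmoves : ∀ {n} → PieceType n → Set
ClosedUnderSubmoves {n} T =
  ∀ (xs ys zs : List (Fin n)) → T (xs ++ ys ++ zs) → 2 ≤ length ys → T ys

Symmetric : ∀ {n} → PieceType n → Set
Symmetric {n} T = ∀ (xs : List (Fin n)) → T xs → T (reverse xs)

_⊆ₜ_ : ∀ {n} → PieceType n → PieceType n → Set
_⊆ₜ_ {n} S T = ∀ (xs : List (Fin n)) → S xs → T xs

Valid : ∀ {n} → State n → Move n → Set
Valid σ m = (σ (start m) ≢ empty) × (σ (end m) ≢ empty)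
          × All (λ ℓ → σ ℓ ≡ empty) (mid m) × (start m ≢ end m)

step : ∀ {n} → State n → Move n → State n
step σ m ℓ with ℓ ≟ end m
... | yes _ = σ (start m)
... | no _ with ℓ ≟ start m
...   | yes _ = empty
...   | no _  = σ ℓ

typeOf : ∀ {n} → PieceType n → PieceType n → Occ → PieceType n
typeOf S T empty   = λ _ → ⊥
typeOf S T villain = T
typeOf S T hero    = S

Legal : ∀ {n} → PieceType n → PieceType n → State n → Move n → Set
Legal S T σ m = Valid σ m × typeOf S T (σ (start m)) (toList m)
              × σ (end m) ≢ hero

data LegalSeq {n} (S T : PieceType n) : State n → List (Move n) → Set where
  done : ∀ {σ} → LegalSeq S T σ []
  _∷_  : ∀ {σ m ms} → Legal S T σ m → LegalSeq S T (step σ m) ms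
       → LegalSeq S T σ (m ∷ ms)

run : ∀ {n} → State n → List (Move n) → State n
run σ []       = σ
run σ (m ∷ ms) = run (step σ m) ms

OnlyHero : ∀ {n} → State n → Set
OnlyHero {n} σ = Σ (Fin n) λ ℓ → (σ ℓ ≡ hero) × (∀ ℓ′ → ℓ′ ≢ ℓ → σ ℓ′ ≡ empty)

Solution : ∀ {n} → PieceType n → PieceType n → State n → List (Move n) → Set
Solution S T σ ms = LegalSeq S T σ ms × OnlyHero (run σ ms)

heroVisits : ∀ {n} → State n → List (Move n) → List (Fin n)
heroVisits σ [] = []
heroVisits σ (m ∷ ms) with σ (start m)
... | hero = end m ∷ heroVisits (step σ m) ms
... | _    = heroVisits (step σ m) ms

data HeroMoves {n} (S : PieceType n) : State n → Fin n → List (Fin n) → Set where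
  stop : ∀ {σ p} → HeroMoves S σ p []
  go   : ∀ {σ p q qs} (m : Move n) → start m ≡ p → end m ≡ q → S (toList m)
       → Valid σ m → HeroMoves S (step σ m) q qs → HeroMoves S σ p (q ∷ qs)

HeroPath : ∀ {n} → PieceType n → Fin n → List (Fin n) → Set
HeroPath S h []       = ⊥
HeroPath S h (p ∷ ps) = (p ≡ h) × HeroMoves S (initial h) p ps

-- Normalise the solution from the front, keeping every hero move valid on the board on which only
-- the hero has moved.  A hero move at the front is kept.  A villain move from a is deleted and the
-- already normalised remainder is replayed on a board with an extra villain at a.  Moves that do not
-- pass over a are unaffected; the first one that does is cut at a.  A villain move cut there captures
-- the extra villain and leaves a villain at a again, while a hero move is split into two submoves
-- that capture the extra villain on the way, after which the two boards agree.  If no move passes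
-- over a, the villain move is put back.  Either way the final board is unchanged, and on the
-- hero-only board, where that villain never left a, the hero moves stay valid.
module Submission where

open import Defs
open import Data.Nat using (ℕ; _≤_; s≤s; z≤n)
open import Data.Fin using (Fin; _≟_)
open import Data.List using (List; []; _∷_; _++_; length)
open import Data.List.Properties using (++-assoc; ++-identityʳ)
open import Data.List.Relation.Unary.All as All using (All; []; _∷_)
open import Data.List.Relation.Unary.All.Properties using (++⁻ˡ; ++⁻ʳ)
open import Data.Product using (∃; ∃₂; _×_; _,_; proj₁)
open import Data.Sum using (_⊎_; inj₁; inj₂)
open import Data.Empty using (⊥-elim)
open import Function using (_∘_)
open import Relation.Nullary using (yes; no)
open import Relation.Binary.PropositionalEquality

villain≢hero : villain ≢ hero
villain≢hero ()

empty≢hero : empty ≢ hero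
empty≢hero ()

villain≢empty : villain ≢ empty
villain≢empty ()

hero-or-villain : ∀ o → o ≢ empty → o ≡ hero ⊎ o ≡ villain
hero-or-villain empty   o≢empty = ⊥-elim (o≢empty refl)
hero-or-villain villain _       = inj₂ refl
hero-or-villain hero    _       = inj₁ refl

villain-if-not-empty-nor-hero : ∀ {o} → o ≢ empty → o ≢ hero → o ≡ villain
villain-if-not-empty-nor-hero {empty}   o≢empty _      = ⊥-elim (o≢empty refl)
villain-if-not-empty-nor-hero {villain} _       _      = refl
villain-if-not-empty-nor-hero {hero}    _       o≢hero = ⊥-elim (o≢hero refl)

module _ {n : ℕ} where

  step-end : ∀ σ (m : Move n) → step σ m (end m) ≡ σ (start m)
  step-end σ m with end m ≟ end m
  ... | yes _  = refl
  ... | no e≢e = ⊥-elim (e≢e refl)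

  step-start : ∀ σ (m : Move n) → start m ≢ end m → step σ m (start m) ≡ empty
  step-start σ m s≢e with start m ≟ end m
  ... | yes s≡e = ⊥-elim (s≢e s≡e)
  ... | no _ with start m ≟ start m
  ...   | yes _  = refl
  ...   | no s≢s = ⊥-elim (s≢s refl)

  step-other : ∀ σ (m : Move n) {x} → x ≢ end m → x ≢ start m → step σ m x ≡ σ x
  step-other σ m {x} x≢e x≢s with x ≟ end m
  ... | yes x≡e = ⊥-elim (x≢e x≡e)
  ... | no _ with x ≟ start m
  ...   | yes x≡s = ⊥-elim (x≢s x≡s)
  ...   | no _    = refl

  step-preserves-empty : ∀ σ (m : Move n) {x} → σ x ≡ empty → x ≢ end m → step σ m x ≡ empty
  step-preserves-empty σ m {x} σx≡empty x≢e with x ≟ end m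
  ... | yes x≡e = ⊥-elim (x≢e x≡e)
  ... | no _ with x ≟ start m
  ...   | yes _ = refl
  ...   | no _  = σx≡empty

  step-cong : ∀ {σ σ′} (m : Move n) → σ ≗ σ′ → step σ m ≗ step σ′ m
  step-cong m σ≗σ′ x with x ≟ end m
  ... | yes _ = σ≗σ′ (start m)
  ... | no _ with x ≟ start m
  ...   | yes _ = refl
  ...   | no _  = σ≗σ′ x

  run-cong : ∀ {σ σ′} (ms : List (Move n)) → σ ≗ σ′ → run σ ms ≗ run σ′ ms
  run-cong []       σ≗σ′ = σ≗σ′
  run-cong (m ∷ ms) σ≗σ′ = run-cong ms (step-cong m σ≗σ′)

  OnlyHero-cong : ∀ {σ σ′ : State n} → σ ≗ σ′ → OnlyHero σ → OnlyHero σ′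
  OnlyHero-cong σ≗σ′ (ℓ , σℓ≡hero , others-empty) =
    ℓ , trans (sym (σ≗σ′ ℓ)) σℓ≡hero , λ ℓ′ ℓ′≢ℓ → trans (sym (σ≗σ′ ℓ′)) (others-empty ℓ′ ℓ′≢ℓ)

  Valid-cong : ∀ {σ σ′} {m : Move n} → σ ≗ σ′ → Valid σ m → Valid σ′ m
  Valid-cong {m = m} σ≗σ′ (s-occ , e-occ , mid-empty , s≢e) =
    subst (_≢ empty) (σ≗σ′ (start m)) s-occ ,
    subst (_≢ empty) (σ≗σ′ (end m)) e-occ ,
    All.map (λ {x} σx≡empty → trans (sym (σ≗σ′ x)) σx≡empty) mid-empty ,
    s≢e

two≤length-toList : ∀ {n} (m : Move n) → 2 ≤ length (toList m)
two≤length-toList (mkMove _ []      _) = s≤s (s≤s z≤n)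
two≤length-toList (mkMove _ (_ ∷ _) _) = s≤s (s≤s z≤n)

module _ {n : ℕ} {C : PieceType n} (closed : ClosedUnderSubmoves C) where

  prefix-submove : ∀ {m : Move n} {xs a ws} → mid m ≡ xs ++ a ∷ ws
                 → C (toList m) → C (toList (mkMove (start m) xs a))
  prefix-submove {mkMove s _ e} {xs} {a} {ws} refl c =
    closed [] (toList (mkMove s xs a)) (ws ++ e ∷ []) (subst C reassoc c) (two≤length-toList (mkMove s xs a))
    where
    reassoc : s ∷ (xs ++ a ∷ ws) ++ e ∷ [] ≡ s ∷ (xs ++ a ∷ []) ++ ws ++ e ∷ []
    reassoc = cong (s ∷_) (trans (++-assoc xs (a ∷ ws) (e ∷ []))
                                 (sym (++-assoc xs (a ∷ []) (ws ++ e ∷ []))))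

  suffix-submove : ∀ {m : Move n} {xs a ws} → mid m ≡ xs ++ a ∷ ws
                 → C (toList m) → C (toList (mkMove a ws (end m)))
  suffix-submove {mkMove s _ e} {xs} {a} {ws} refl c =
    closed (s ∷ xs) (toList (mkMove a ws e)) [] (subst C reassoc c) (two≤length-toList (mkMove a ws e))
    where
    reassoc : s ∷ (xs ++ a ∷ ws) ++ e ∷ [] ≡ s ∷ xs ++ (a ∷ ws ++ e ∷ []) ++ []
    reassoc = cong (s ∷_) (trans (++-assoc xs (a ∷ ws) (e ∷ []))
                                 (cong (xs ++_) (sym (++-identityʳ (a ∷ ws ++ e ∷ [])))))

typeOf-closed : ∀ {n} {S T : PieceType n} → ClosedUnderSubmoves S → ClosedUnderSubmoves T
              → ∀ o → ClosedUnderSubmoves (typeOf S T o)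
typeOf-closed S-closed T-closed empty   _ _ _ ()
typeOf-closed S-closed T-closed villain = T-closed
typeOf-closed S-closed T-closed hero    = S-closed

module _ {n : ℕ} where

  record ExtraVillain (a : Fin n) (X Y : State n) : Set where
    field
      villain-at : X a ≡ villain
      empty-at   : Y a ≡ empty
      agree-off  : ∀ {x} → x ≢ a → X x ≡ Y x
  open ExtraVillain public

  occupied-≢ : ∀ {Y : State n} {x a} → Y x ≢ empty → Y a ≡ empty → x ≢ a
  occupied-≢ Yx≢empty Ya≡empty refl = Yx≢empty Ya≡empty

  villain-move-extra : ∀ {σ} {m : Move n} → Valid σ m → σ (start m) ≡ villain → σ (end m) ≡ villain
                     → ExtraVillain (start m) σ (step σ m)
  villain-move-extra {σ} {m} (_ , _ , _ , s≢e) σs≡villain σe≡villain = record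
    { villain-at = σs≡villain
    ; empty-at   = step-start σ m s≢e
    ; agree-off  = agree
    }
    where
    agree : ∀ {x} → x ≢ start m → σ x ≡ step σ m x
    agree {x} x≢s with x ≟ end m
    ... | yes refl = trans σe≡villain (sym σs≡villain)
    ... | no _ with x ≟ start m
    ...   | yes x≡s = ⊥-elim (x≢s x≡s)
    ...   | no _    = refl

  module _ {a : Fin n} {X Y : State n} (extra : ExtraVillain a X Y) where

    agree-occupied : ∀ {x} → Y x ≢ empty → X x ≡ Y x
    agree-occupied occ = agree-off extra (occupied-≢ occ (empty-at extra))

    occupied-transfer : ∀ {x} → Y x ≢ empty → X x ≢ empty
    occupied-transfer occ = subst (_≢ empty) (sym (agree-occupied occ)) occ

    empty-transfer : ∀ {xs} → All (_≢ a) xs → All (λ x → Y x ≡ empty) xs → All (λ x → X x ≡ empty) xs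
    empty-transfer avoid empties =
      All.zipWith (λ (x≢a , Yx≡empty) → trans (agree-off extra x≢a) Yx≡empty) (avoid , empties)

    valid-avoiding : ∀ {m} → Valid Y m → All (_≢ a) (mid m) → Valid X m
    valid-avoiding (s-occ , e-occ , mid-empty , s≢e) avoid =
      occupied-transfer s-occ , occupied-transfer e-occ , empty-transfer avoid mid-empty , s≢e

    step-extra : ∀ {m} → Valid Y m → ExtraVillain a (step X m) (step Y m)
    step-extra {m} (s-occ , e-occ , _ , _) = record
      { villain-at = trans (step-other X m a≢e a≢s) (villain-at extra)
      ; empty-at   = trans (step-other Y m a≢e a≢s) (empty-at extra)
      ; agree-off  = agree
      }
      where
      a≢s : a ≢ start m
      a≢s = ≢-sym (occupied-≢ s-occ (empty-at extra))
      a≢e : a ≢ end m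
      a≢e = ≢-sym (occupied-≢ e-occ (empty-at extra))
      agree : ∀ {x} → x ≢ a → step X m x ≡ step Y m x
      agree {x} x≢a with x ≟ end m
      ... | yes _ = agree-occupied s-occ
      ... | no _ with x ≟ start m
      ...   | yes _ = refl
      ...   | no _  = agree-off extra x≢a

    module _ {m : Move n} (valid : Valid Y m) where

      private
        s-occ : Y (start m) ≢ empty
        s-occ = let (occ , _) = valid in occ
        e-occ : Y (end m) ≢ empty
        e-occ = let (_ , occ , _) = valid in occ
        s≢a : start m ≢ a
        s≢a = occupied-≢ s-occ (empty-at extra)
        e≢a : end m ≢ a
        e≢a = occupied-≢ e-occ (empty-at extra)
        mid-empty : All (λ x → Y x ≡ empty) (mid m)
        mid-empty = let (_ , _ , empties , _) = valid in empties
        s≢e : start m ≢ end m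
        s≢e = let (_ , _ , _ , s≢e) = valid in s≢e

      after-prefix-at-a : ∀ xs → step X (mkMove (start m) xs a) a ≡ Y (start m)
      after-prefix-at-a xs = trans (step-end X (mkMove (start m) xs a)) (agree-occupied s-occ)

      after-prefix-at-end : ∀ xs → step X (mkMove (start m) xs a) (end m) ≡ Y (end m)
      after-prefix-at-end xs =
        trans (step-other X (mkMove (start m) xs a) e≢a (≢-sym s≢e)) (agree-occupied e-occ)

      valid-prefix : ∀ {xs ws} → mid m ≡ xs ++ a ∷ ws → All (_≢ a) xs
                   → Valid X (mkMove (start m) xs a)
      valid-prefix {xs} split avoid =
        occupied-transfer s-occ ,
        subst (_≢ empty) (sym (villain-at extra)) villain≢empty ,
        empty-transfer avoid (++⁻ˡ xs (subst (All _) split mid-empty)) ,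
        s≢a

      valid-suffix : ∀ {xs us ys} → mid m ≡ us ++ a ∷ ys → All (_≢ a) ys
                   → Valid (step X (mkMove (start m) xs a)) (mkMove a ys (end m))
      valid-suffix {xs} {us} split avoid =
        subst (_≢ empty) (sym (after-prefix-at-a xs)) s-occ ,
        subst (_≢ empty) (sym (after-prefix-at-end xs)) e-occ ,
        All.zipWith (λ (y≢a , Xy≡empty) → step-preserves-empty X m₁ Xy≡empty y≢a)
                    (avoid , empty-transfer avoid (All.tail (++⁻ʳ us (subst (All _) split mid-empty)))) ,
        ≢-sym e≢a
        where m₁ = mkMove (start m) xs a

      step-through : ∀ xs ys → step (step X (mkMove (start m) xs a)) (mkMove a ys (end m)) ≗ step Y m
      step-through xs ys x with x ≟ end m
      ... | yes _ = after-prefix-at-a xs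
      ... | no _ with x ≟ a | x ≟ start m
      ...   | yes _    | yes _   = refl
      ...   | yes refl | no _    = sym (empty-at extra)
      ...   | no _     | yes refl = step-start X (mkMove x xs a) s≢a
      ...   | no x≢a   | no x≢s  = trans (step-other X (mkMove (start m) xs a) x≢a x≢s) (agree-off extra x≢a)

      redirect-extra : ∀ xs → Y (start m) ≡ villain → Y (end m) ≡ villain
                     → ExtraVillain a (step X (mkMove (start m) xs a)) (step Y m)
      redirect-extra xs Ys≡villain Ye≡villain = record
        { villain-at = trans (after-prefix-at-a xs) Ys≡villain
        ; empty-at   = trans (step-other Y m (≢-sym e≢a) (≢-sym s≢a)) (empty-at extra)
        ; agree-off  = agree
        }
        where
        m₁ = mkMove (start m) xs a
        agree : ∀ {x} → x ≢ a → step X m₁ x ≡ step Y m x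
        agree {x} x≢a with x ≟ end m
        ... | yes refl = trans (after-prefix-at-end xs) (trans Ye≡villain (sym Ys≡villain))
        ... | no _ with x ≟ start m
        ...   | yes refl = step-start X m₁ s≢a
        ...   | no x≢s   = trans (step-other X m₁ x≢a x≢s) (agree-off extra x≢a)

module _ {n : ℕ} (a : Fin n) where

  first-occurrence : ∀ zs → All (_≢ a) zs ⊎ ∃₂ λ xs ws → zs ≡ xs ++ a ∷ ws × All (_≢ a) xs
  first-occurrence [] = inj₁ []
  first-occurrence (z ∷ zs) with z ≟ a
  ... | yes refl = inj₂ ([] , zs , refl , [])
  ... | no z≢a with first-occurrence zs
  ...   | inj₁ avoid                    = inj₁ (z≢a ∷ avoid)
  ...   | inj₂ (xs , ws , split , avoid) = inj₂ (z ∷ xs , ws , cong (z ∷_) split , z≢a ∷ avoid)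

  last-occurrence : ∀ zs → All (_≢ a) zs ⊎ ∃₂ λ xs ws → zs ≡ xs ++ a ∷ ws × All (_≢ a) ws
  last-occurrence [] = inj₁ []
  last-occurrence (z ∷ zs) with last-occurrence zs
  ... | inj₂ (xs , ws , split , avoid) = inj₂ (z ∷ xs , ws , cong (z ∷_) split , avoid)
  ... | inj₁ avoid with z ≟ a
  ...   | yes refl = inj₂ ([] , zs , refl , avoid)
  ...   | no z≢a   = inj₁ (z≢a ∷ avoid)

  split-at-last : ∀ xs ws → ∃₂ λ us ys → xs ++ a ∷ ws ≡ us ++ a ∷ ys × All (_≢ a) ys
  split-at-last xs ws with last-occurrence ws
  ... | inj₁ avoid = xs , ws , refl , avoid
  ... | inj₂ (us , ys , refl , avoid) = xs ++ a ∷ us , ys , sym (++-assoc xs (a ∷ us) (a ∷ ys)) , avoid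

module _ {n : ℕ} where

  HeroAt : Fin n → State n → Set
  HeroAt p σ = σ p ≡ hero × (∀ {x} → σ x ≡ hero → x ≡ p)

  hero-move-HeroAt : ∀ {p σ} {m : Move n} → HeroAt p σ → σ (start m) ≡ hero
                   → start m ≡ p × HeroAt (end m) (step σ m)
  hero-move-HeroAt {σ = σ} {m} (_ , unique) σs≡hero =
    unique σs≡hero , trans (step-end σ m) σs≡hero , at-end
    where
    at-end : ∀ {x} → step σ m x ≡ hero → x ≡ end m
    at-end {x} hero-at-x with x ≟ end m
    ... | yes x≡e = x≡e
    ... | no _ with x ≟ start m
    ...   | yes _  = ⊥-elim (empty≢hero hero-at-x)
    ...   | no x≢s = ⊥-elim (x≢s (trans (unique hero-at-x) (sym (unique σs≡hero))))

  villain-move-HeroAt : ∀ {p σ} {m : Move n} → HeroAt p σ → σ (start m) ≡ villain → σ (end m) ≢ hero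
                      → HeroAt p (step σ m)
  villain-move-HeroAt {p} {σ} {m} (σp≡hero , unique) σs≡villain σe≢hero =
    trans (step-other σ m p≢e p≢s) σp≡hero , at-p
    where
    p≢e : p ≢ end m
    p≢e refl = σe≢hero σp≡hero
    p≢s : p ≢ start m
    p≢s refl = villain≢hero (trans (sym σs≡villain) σp≡hero)
    at-p : ∀ {x} → step σ m x ≡ hero → x ≡ p
    at-p {x} hero-at-x with x ≟ end m
    ... | yes _ = ⊥-elim (villain≢hero (trans (sym σs≡villain) hero-at-x))
    ... | no _ with x ≟ start m
    ...   | yes _ = ⊥-elim (empty≢hero hero-at-x)
    ...   | no _  = unique hero-at-x

  initial-HeroAt : ∀ h → HeroAt h (initial h)
  initial-HeroAt h = hero-at-h , unique
    where
    hero-at-h : initial h h ≡ hero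
    hero-at-h with h ≟ h
    ... | yes _  = refl
    ... | no h≢h = ⊥-elim (h≢h refl)
    unique : ∀ {x} → initial h x ≡ hero → x ≡ h
    unique {x} hero-at-x with x ≟ h
    ... | yes x≡h = x≡h
    ... | no _    = ⊥-elim (villain≢hero hero-at-x)

module _ {n : ℕ} (S T : PieceType n) where

  agree-start : ∀ {a X Y} {m : Move n} → ExtraVillain a X Y → Legal S T Y m → X (start m) ≡ Y (start m)
  agree-start extra ((s-occ , _) , _) = agree-occupied extra s-occ

  legal-avoiding : ∀ {a X Y} {m : Move n} → ExtraVillain a X Y → Legal S T Y m → All (_≢ a) (mid m)
                 → Legal S T X m
  legal-avoiding {m = m} extra legal@(valid@(_ , e-occ , _) , typed , Ye≢hero) avoid =
    valid-avoiding extra valid avoid ,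
    subst (λ o → typeOf S T o (toList m)) (sym (agree-start extra legal)) typed ,
    subst (_≢ hero) (sym (agree-occupied extra e-occ)) Ye≢hero

  Legal-cong : ∀ {σ σ′} {m : Move n} → σ ≗ σ′ → Legal S T σ m → Legal S T σ′ m
  Legal-cong {m = m} σ≗σ′ (valid , typed , σe≢hero) =
    Valid-cong σ≗σ′ valid ,
    subst (λ o → typeOf S T o (toList m)) (σ≗σ′ (start m)) typed ,
    subst (_≢ hero) (σ≗σ′ (end m)) σe≢hero

  -- ρ is the board on which only the hero's moves have been made; a tracked sequence is a legal
  -- sequence from σ with the hero at p whose hero moves are also valid on ρ.
  data Tracked (ρ σ : State n) (p : Fin n) : List (Move n) → Set where
    []           : Tracked ρ σ p []
    hero-move    : ∀ {m ms} → Legal S T σ m → σ (start m) ≡ hero → start m ≡ p → Valid ρ m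
                 → Tracked (step ρ m) (step σ m) (end m) ms → Tracked ρ σ p (m ∷ ms)
    villain-move : ∀ {m ms} → Legal S T σ m → σ (start m) ≡ villain
                 → Tracked ρ (step σ m) p ms → Tracked ρ σ p (m ∷ ms)

  Tracked→LegalSeq : ∀ {ρ σ p ms} → Tracked ρ σ p ms → LegalSeq S T σ ms
  Tracked→LegalSeq []                             = done
  Tracked→LegalSeq (hero-move legal _ _ _ tracked) = legal ∷ Tracked→LegalSeq tracked
  Tracked→LegalSeq (villain-move legal _ tracked)  = legal ∷ Tracked→LegalSeq tracked

  Tracked→HeroMoves : ∀ {ρ σ p ms} → Tracked ρ σ p ms → HeroMoves S ρ p (heroVisits σ ms)
  Tracked→HeroMoves [] = stop
  Tracked→HeroMoves {σ = σ} (hero-move {m} legal σs≡hero s≡p valid tracked)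
    with σ (start m) | σs≡hero | legal
  ... | .hero | refl | (_ , typed , _) = go m s≡p refl typed valid (Tracked→HeroMoves tracked)
  Tracked→HeroMoves {σ = σ} (villain-move {m} _ σs≡villain tracked)
    with σ (start m) | σs≡villain
  ... | .villain | refl = Tracked→HeroMoves tracked

  Tracked-cong : ∀ {ρ ρ′ σ σ′ p ms} → ρ ≗ ρ′ → σ ≗ σ′ → Tracked ρ σ p ms → Tracked ρ′ σ′ p ms
  Tracked-cong ρ≗ρ′ σ≗σ′ [] = []
  Tracked-cong ρ≗ρ′ σ≗σ′ (hero-move {m} legal σs≡hero s≡p valid tracked) =
    hero-move (Legal-cong σ≗σ′ legal) (trans (sym (σ≗σ′ (start m))) σs≡hero) s≡p (Valid-cong ρ≗ρ′ valid)
              (Tracked-cong (step-cong m ρ≗ρ′) (step-cong m σ≗σ′) tracked)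
  Tracked-cong ρ≗ρ′ σ≗σ′ (villain-move {m} legal σs≡villain tracked) =
    villain-move (Legal-cong σ≗σ′ legal) (trans (sym (σ≗σ′ (start m))) σs≡villain)
                 (Tracked-cong ρ≗ρ′ (step-cong m σ≗σ′) tracked)

  module _ (S-closed : ClosedUnderSubmoves S) (T-closed : ClosedUnderSubmoves T) where

    legal-prefix : ∀ {a X Y} {m : Move n} {xs ws} → ExtraVillain a X Y → Legal S T Y m
                 → mid m ≡ xs ++ a ∷ ws → All (_≢ a) xs → Legal S T X (mkMove (start m) xs a)
    legal-prefix {Y = Y} {m = m} extra legal@(valid , typed , _) split avoid =
      valid-prefix extra valid split avoid ,
      subst (λ o → typeOf S T o _) (sym (agree-start extra legal))
            (prefix-submove (typeOf-closed S-closed T-closed (Y (start m))) split typed) ,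
      subst (_≢ hero) (sym (villain-at extra)) villain≢hero

    legal-suffix : ∀ {a X Y} {m : Move n} {xs us ys} → ExtraVillain a X Y → Legal S T Y m
                 → mid m ≡ us ++ a ∷ ys → All (_≢ a) ys
                 → Legal S T (step X (mkMove (start m) xs a)) (mkMove a ys (end m))
    legal-suffix {Y = Y} {m} {xs} extra (valid , typed , Ye≢hero) split avoid =
      valid-suffix extra valid split avoid ,
      subst (λ o → typeOf S T o _) (sym (after-prefix-at-a extra valid xs))
            (suffix-submove (typeOf-closed S-closed T-closed (Y (start m))) split typed) ,
      subst (_≢ hero) (sym (after-prefix-at-end extra valid xs)) Ye≢hero

    Rerouted : State n → State n → State n → Fin n → List (Move n) → Set
    Rerouted τ τ′ ρ p ms = Tracked ρ τ′ p ms ⊎ ∃ λ ms′ → Tracked ρ τ p ms′ × run τ ms′ ≗ run τ′ ms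

    hero-through : ∀ {a τ τ′ ρ ρ′ p ms} {m : Move n} {xs ws}
                 → ExtraVillain a τ τ′ → ExtraVillain a ρ ρ′
                 → Legal S T τ′ m → τ′ (start m) ≡ hero → start m ≡ p → Valid ρ′ m
                 → Tracked (step ρ′ m) (step τ′ m) (end m) ms
                 → mid m ≡ xs ++ a ∷ ws → All (_≢ a) xs
                 → ∃ λ ms′ → Tracked ρ τ p ms′ × run τ ms′ ≗ run τ′ (m ∷ ms)
    hero-through {a} {ms = ms} {m} {xs} {ws} τ-extra ρ-extra legal τ′s≡hero s≡p valid tracked split avoid
      with split-at-last a xs ws
    ... | us , ys , split′ , avoid′ =
      mkMove (start m) xs a ∷ mkMove a ys (end m) ∷ ms ,
      hero-move (legal-prefix τ-extra legal split avoid) τs≡hero s≡p (valid-prefix ρ-extra valid split avoid)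
        (hero-move (legal-suffix τ-extra legal last-split avoid′)
                   (trans (after-prefix-at-a τ-extra (proj₁ legal) xs) τ′s≡hero) refl
                   (valid-suffix ρ-extra valid last-split avoid′)
                   (Tracked-cong (sym ∘ step-through ρ-extra valid xs ys)
                                 (sym ∘ step-through τ-extra (proj₁ legal) xs ys) tracked)) ,
      run-cong ms (step-through τ-extra (proj₁ legal) xs ys)
      where
      last-split = trans split split′
      τs≡hero = trans (agree-start τ-extra legal) τ′s≡hero

    reroute : ∀ {a τ τ′ ρ ρ′ p ms} → ExtraVillain a τ τ′ → ExtraVillain a ρ ρ′
            → Tracked ρ′ τ′ p ms → Rerouted τ τ′ ρ p ms
    reroute τ-extra ρ-extra [] = inj₁ []
    reroute {a} τ-extra ρ-extra (hero-move {m} legal τ′s≡hero s≡p valid tracked)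
      with first-occurrence a (mid m)
    ... | inj₂ (xs , ws , split , avoid) =
      inj₂ (hero-through τ-extra ρ-extra legal τ′s≡hero s≡p valid tracked split avoid)
    ... | inj₁ avoid with reroute (step-extra τ-extra (proj₁ legal)) (step-extra ρ-extra valid) tracked
    ...   | inj₁ tracked′ = inj₁ (hero-move legal τ′s≡hero s≡p (valid-avoiding ρ-extra valid avoid) tracked′)
    ...   | inj₂ (ms′ , tracked′ , same) =
      inj₂ (m ∷ ms′ ,
            hero-move (legal-avoiding τ-extra legal avoid) (trans (agree-start τ-extra legal) τ′s≡hero)
                      s≡p (valid-avoiding ρ-extra valid avoid) tracked′ ,
            same)
    reroute {a} τ-extra ρ-extra
            (villain-move {m} legal@(valid@(_ , e-occ , _) , _ , τ′e≢hero) τ′s≡villain tracked)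
      with first-occurrence a (mid m)
    ... | inj₂ (xs , ws , split , avoid)
      with reroute (redirect-extra τ-extra valid xs τ′s≡villain
                                   (villain-if-not-empty-nor-hero e-occ τ′e≢hero))
                   ρ-extra tracked
    ...   | inj₁ tracked′ = inj₁ (villain-move legal τ′s≡villain tracked′)
    ...   | inj₂ (ms′ , tracked′ , same) =
      inj₂ (mkMove (start m) xs a ∷ ms′ ,
            villain-move (legal-prefix τ-extra legal split avoid)
                         (trans (agree-start τ-extra legal) τ′s≡villain) tracked′ ,
            same)
    reroute τ-extra ρ-extra (villain-move {m} legal τ′s≡villain tracked)
      | inj₁ avoid with reroute (step-extra τ-extra (proj₁ legal)) ρ-extra tracked
    ...   | inj₁ tracked′ = inj₁ (villain-move legal τ′s≡villain tracked′)
    ...   | inj₂ (ms′ , tracked′ , same) =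
      inj₂ (m ∷ ms′ ,
            villain-move (legal-avoiding τ-extra legal avoid) (trans (agree-start τ-extra legal) τ′s≡villain)
                         tracked′ ,
            same)

    track : ∀ {σ p ms} → HeroAt p σ → LegalSeq S T σ ms
          → ∃ λ ms′ → Tracked σ σ p ms′ × run σ ms′ ≗ run σ ms
    track at done = [] , [] , λ _ → refl
    track {σ} at (_∷_ {m = m} legal@(valid@(s-occ , _) , _) legals)
      with hero-or-villain (σ (start m)) s-occ
    ... | inj₁ σs≡hero =
      let s≡p , at′ = hero-move-HeroAt at σs≡hero
          ms′ , tracked , same = track at′ legals
      in m ∷ ms′ , hero-move legal σs≡hero s≡p valid tracked , same
    track at (_∷_ {m = m} legal@(valid@(_ , e-occ , _) , _ , σe≢hero) legals)
      | inj₂ σs≡villain with track (villain-move-HeroAt at σs≡villain σe≢hero) legals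
    ... | ms′ , tracked , same with reroute extra extra tracked
      where extra = villain-move-extra valid σs≡villain (villain-if-not-empty-nor-hero e-occ σe≢hero)
    ...   | inj₁ tracked′ = m ∷ ms′ , villain-move legal σs≡villain tracked′ , same
    ...   | inj₂ (ms″ , tracked″ , same′) = ms″ , tracked″ , λ x → trans (same′ x) (same x)

lemma9 : (n : ℕ) (S T : PieceType n)
    → ClosedUnderSubmoves S → ClosedUnderSubmoves T
    → S ⊆ₜ T → Symmetric T
    → (h : Fin n)
    → ∃ (λ ms → Solution S T (initial h) ms)
    → ∃ (λ ms → Solution S T (initial h) ms
    × HeroPath S h (h ∷ heroVisits (initial h) ms))
lemma9 n S T S-closed T-closed _ _ h (ms , legals , only-hero)
  with track S T S-closed T-closed (initial-HeroAt h) legals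
... | ms′ , tracked , same =
  ms′ , (Tracked→LegalSeq S T tracked , OnlyHero-cong (sym ∘ same) only-hero) ,
  refl , Tracked→HeroMoves S T tracked
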